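{- For every integer $n\ge 1$, $$\pi_\vartheta(p_{n+1}^2)-\pi_\vartheta(p_n^2)\ge 2g_n,$$ where $g_n=p_{n+1}-p_n$.
   Context: $p_n$ denotes the $n$-th prime ($p_1=2$), $g_n=p_{n+1}-p_n$ is the ordinary prime gap, $\vartheta_n=\sum_{i=1}^n\ln p_i$, and $\pi_\vartheta(x)=\#\{i\ge1:\vartheta_i\le x\}$. -}

module Defs where

open import Data.Nat using (ℕ; zero; suc; _+_; _*_; _^_; _≤_; _<_; _!)
open import Data.Nat.Primality using (prime?)
open import Data.List using (List; length)
open import Data.List.Membership.Propositional using (_∈_)
open import Data.List.Relation.Unary.Unique.Propositional using (Unique)
open import Data.Product using (Σ; _×_)
open import Relation.Nullary using (¬_; yes; no)
open import Relation.Binary.PropositionalEquality using (_≡_)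
open import Function.Bundles using (_⇔_)

firstPrimeFrom : ℕ → ℕ → ℕ
firstPrimeFrom zero       start = 0
firstPrimeFrom (suc fuel) start with prime? start
... | yes _ = start
... | no  _ = firstPrimeFrom fuel (suc start)

-- next prime after q: some prime lies in [q+1, q!+1] (Euclid), so fuel q ! suffices
nextPrime : ℕ → ℕ
nextPrime q = firstPrimeFrom (q !) (suc q)

-- p n = the n-th prime, 1-indexed (p 1 = 2); p 0 = 0 is an unused junk value
p : ℕ → ℕ
p zero = 0
p (suc zero) = 2
p (suc (suc n)) = nextPrime (p (suc n))

g : ℕ → ℕ
g n = p (suc n) Data.Nat.∸ p n

-- primorial P i = p_1 * ... * p_i, so that ϑ_i = ln (P i)
P : ℕ → ℕ
P zero = 1
P (suc i) = P i * p (suc i)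

-- expT m k = k! * Σ_{j=0}^{k} m^j / j!   (an exact natural number)
expT : ℕ → ℕ → ℕ
expT m zero = 1
expT m (suc k) = suc k * expT m k + m ^ suc k

-- N ≤ e^m  (real inequality), expressed via the partial sums S_k = expT m k / k!
-- of the exponential series, which increase strictly to e^m:
-- N ≤ e^m  iff  not every partial sum is < N.
LeExp : ℕ → ℕ → Set
LeExp N m = ¬ ((k : ℕ) → expT m k < N * (k !))

-- ϑ_i ≤ x   ⇔   P i ≤ e^x   (for natural x)
ThetaLe : ℕ → ℕ → Set
ThetaLe i x = LeExp (P i) x

-- "π_ϑ(x) = c": the set {i ≥ 1 : ϑ_i ≤ x} is enumerated by a duplicate-free list of length c
PiThetaIs : ℕ → ℕ → Set
PiThetaIs x c = Σ (List ℕ) λ L →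
  Unique L × ((i : ℕ) → (i ∈ L) ⇔ (1 ≤ i × ThetaLe i x)) × length L ≡ c

-- Write s = p_n, t = p_(n+1) = s + g. If ϑ_a ≤ s², then ϑ_(a+2g) ≤ ϑ_a + 2g ln p_(a+2g), so it suffices
-- that p_(a+2g) ≤ 2^u for u = s + ⌊g/2⌋: then 2g·u ln 2 ≤ 2gu ≤ g(s + t) = t² − s². Since ϑ_a ≥ ln (a+1)!, the
-- index a + 2g is below 4u² + 4u, and Chebyshev's bound π(2^u) ≥ 2^(u−1)/u, from
-- 2^n ≤ C(2n,n) ≤ lcm(1,…,2n) ≤ (2n)^π(2n), makes p_(a+2g) ≤ 2^u as soon as u ≥ 15, i.e. for n ≥ 6.
-- The cases n ≤ 5 are settled by evaluating partial sums of the exponential series.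
module Submission where

open import Defs
open import Data.List using (List; []; _∷_; _++_; length; applyUpTo)
open import Data.List.Membership.Propositional.Properties
  using (∈-∃++; ∈-++⁻; ∈-++⁺ˡ; ∈-++⁺ʳ; ∈-applyUpTo⁺; ∈-applyUpTo⁻)
open import Data.List.Properties using (length-++; length-applyUpTo)
open import Data.List.Relation.Binary.Subset.Propositional using (_⊆_)
open import Data.List.Relation.Unary.All as All using (_∷_)
open import Data.List.Relation.Unary.Any using (here; there)
open import Data.List.Relation.Unary.Unique.Propositional using (Unique; _∷_)
open import Data.List.Relation.Unary.Unique.Propositional.Properties using (applyUpTo⁺₁)
open import Data.Nat
open import Data.Nat.Combinatorics using (_C_; nCk+nC[k+1]≡[n+1]C[k+1]; nC1≡n)
open import Data.Nat.Coprimality using (Coprime; coprime⇒gcd≡1)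
open import Data.Nat.Divisibility
open import Data.Nat.GCD using (gcd)
open import Data.Nat.Induction using (<-wellFounded)
open import Data.Nat.LCM using (lcm; m∣lcm[m,n]; n∣lcm[m,n]; lcm-least; gcd*lcm)
open import Data.Nat.ListAction.Properties using (∈⇒∣product)
open import Data.Nat.Logarithm using (⌊log₂⌋-mono-≤; ⌊log₂[2^n]⌋≡n)
open import Data.Nat.Primality
open import Data.Nat.Primality.Factorisation using (factorise)
open import Data.Nat.Properties
open import Algebra.Properties.CommutativeSemigroup *-commutativeSemigroup
  using (x∙yz≈y∙xz; xy∙z≈x∙zy; xy∙z≈xz∙y; interchange)
open import Data.Nat.Tactic.RingSolver using (solve-∀)
open import Data.Product using (∃-syntax; _×_; _,_; proj₁; proj₂)
open import Data.Sum using (_⊎_; inj₁; inj₂; [_,_]′)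
open import Data.Unit using (tt)
open import Function.Bundles using (Equivalence)
open import Induction.WellFounded using (Acc; acc)
open import Relation.Binary.PropositionalEquality
open import Relation.Nullary using (¬_; yes; no; contradiction)

≤-mono-by-step : (f : ℕ → ℕ) → (∀ n → f n ≤ f (suc n)) → ∀ {m n} → m ≤ n → f m ≤ f n
≤-mono-by-step f step m≤n with m≤n⇒m<n∨m≡n m≤n
... | inj₂ refl = ≤-refl
≤-mono-by-step f step {m} {suc n} _ | inj₁ (s≤s m≤n) = ≤-trans (≤-mono-by-step f step m≤n) (step n)

prime⇒2≤ : ∀ {q} → Prime q → 2 ≤ q
prime⇒2≤ {q} pr = nonTrivial⇒n>1 q {{prime⇒nonTrivial pr}}

primeDivisor : ∀ n → 2 ≤ n → ∃[ q ] Prime q × q ∣ n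
primeDivisor (suc zero) (s≤s ())
primeDivisor n@(suc (suc _)) _ with factorise n
... | record { factors = q ∷ qs ; isFactorisation = n≡∏ ; factorsPrime = q-prime ∷ _ } =
  q , q-prime , subst (q ∣_) (sym n≡∏) (∈⇒∣product {ns = q ∷ qs} (here refl))
... | record { factors = [] ; isFactorisation = () }

∣n! : ∀ {m} n → 1 ≤ m → m ≤ n → m ∣ n !
∣n! zero 1≤m m≤0 = contradiction (≤-trans 1≤m m≤0) λ ()
∣n! (suc n) 1≤m m≤1+n with m≤n⇒m<n∨m≡n m≤1+n
... | inj₂ refl = m∣m*n (n !)
... | inj₁ (s≤s m≤n) = ∣n⇒∣m*n (suc n) (∣n! n 1≤m m≤n)

-- A prime factor of q ! + 1 cannot divide q !.
euclid : ∀ q → ∃[ r ] Prime r × q < r × r ≤ suc (q !)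
euclid q with primeDivisor (suc (q !)) (s≤s (1≤n! q))
... | r , r-prime , r∣q!+1 = r , r-prime , q<r , ∣⇒≤ r∣q!+1
  where
  r∣1 : r ≤ q → r ∣ 1
  r∣1 r≤q = ∣m+n∣m⇒∣n (subst (r ∣_) (+-comm 1 (q !)) r∣q!+1) (∣n! q (≤-trans (s≤s z≤n) (prime⇒2≤ r-prime)) r≤q)
  q<r : q < r
  q<r = ≰⇒> λ r≤q → ¬prime[1] (subst Prime (∣1⇒≡1 (r∣1 r≤q)) r-prime)

IsLeastPrimeFrom : ℕ → ℕ → Set
IsLeastPrimeFrom start q = Prime q × start ≤ q × (∀ {r} → Prime r → start ≤ r → q ≤ r)

≤∧¬Prime⇒< : ∀ {start r} → ¬ Prime start → Prime r → start ≤ r → suc start ≤ r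
≤∧¬Prime⇒< ¬start-prime r-prime start≤r = ≤∧≢⇒< start≤r (λ { refl → ¬start-prime r-prime })

firstPrimeFrom-least : ∀ fuel start {r} → Prime r → start ≤ r → r < start + fuel →
                       IsLeastPrimeFrom start (firstPrimeFrom fuel start)
firstPrimeFrom-least zero start {r} _ start≤r r<start+0 =
  contradiction (subst (r <_) (+-identityʳ start) r<start+0) (≤⇒≯ start≤r)
firstPrimeFrom-least (suc fuel) start {r} r-prime start≤r r<start+fuel+1 with prime? start
... | yes start-prime = start-prime , ≤-refl , λ _ start≤r′ → start≤r′
... | no ¬start-prime
  with q-prime , start<q , least ← firstPrimeFrom-least fuel (suc start) r-prime
                                     (≤∧¬Prime⇒< ¬start-prime r-prime start≤r)
                                     (subst (r <_) (+-suc start fuel) r<start+fuel+1)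
  = q-prime , <⇒≤ start<q , λ r′-prime start≤r′ → least r′-prime (≤∧¬Prime⇒< ¬start-prime r′-prime start≤r′)

nextPrime-least : ∀ q → 1 ≤ q → IsLeastPrimeFrom (suc q) (nextPrime q)
nextPrime-least q 1≤q with r , r-prime , q<r , r≤q!+1 ← euclid q =
  firstPrimeFrom-least (q !) (suc q) r-prime q<r
    (s≤s (≤-trans r≤q!+1 (+-monoˡ-≤ (q !) 1≤q)))

p-prime : ∀ i → Prime (p (suc i))
p-next : ∀ i → IsLeastPrimeFrom (suc (p (suc i))) (p (suc (suc i)))

p-prime zero = prime[2]
p-prime (suc i) = proj₁ (p-next i)
p-next i = nextPrime-least (p (suc i)) (≤-trans (s≤s z≤n) (prime⇒2≤ (p-prime i)))

p-< : ∀ i → p (suc i) < p (suc (suc i))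
p-< i = proj₁ (proj₂ (p-next i))

p-mono-≤ : ∀ {i j} → i ≤ j → p i ≤ p j
p-mono-≤ = ≤-mono-by-step p step
  where
  step : ∀ n → p n ≤ p (suc n)
  step zero = z≤n
  step (suc i) = <⇒≤ (p-< i)

2+i≤p[1+i] : ∀ i → 2 + i ≤ p (suc i)
2+i≤p[1+i] zero = ≤-refl
2+i≤p[1+i] (suc i) = ≤-trans (s≤s (2+i≤p[1+i] i)) (p-< i)

primeCount : ℕ → ℕ
primeCount zero = 0
primeCount (suc N) with prime? (suc N)
... | yes _ = suc (primeCount N)
... | no  _ = primeCount N

p≤ : ∀ {M} N → M ≤ primeCount N → p M ≤ N
p≤ {zero} N _ = z≤n
p≤ {suc M} (suc N) M<πN+1 with prime? (suc N)
... | no _ = m≤n⇒m≤1+n (p≤ N M<πN+1)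
... | yes N+1-prime with m≤n⇒m<n∨m≡n M<πN+1
...   | inj₁ (s≤s M<πN) = m≤n⇒m≤1+n (p≤ N M<πN)
...   | inj₂ refl = last (primeCount N) refl
  where
  last : ∀ c → c ≡ primeCount N → p (suc c) ≤ suc N
  last zero _ = prime⇒2≤ N+1-prime
  last (suc c) c≡πN = proj₂ (proj₂ (p-next c)) N+1-prime (s≤s (p≤ N (≤-reflexive c≡πN)))

-- Primorials and partial sums of the exponential series

P-mono-≤ : ∀ {i j} → i ≤ j → P i ≤ P j
P-mono-≤ = ≤-mono-by-step P λ i → m≤m*n (P i) (p (suc i)) {{>-nonZero (≤-trans (s≤s z≤n) (2+i≤p[1+i] i))}}

[1+a]!≤P : ∀ a → suc a ! ≤ P a
[1+a]!≤P zero = ≤-refl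
[1+a]!≤P (suc a) = begin
  suc (suc a) * suc a ! ≡⟨ *-comm (suc (suc a)) (suc a !) ⟩
  suc a ! * suc (suc a) ≤⟨ *-mono-≤ ([1+a]!≤P a) (2+i≤p[1+i] a) ⟩
  P a * p (suc a)       ∎
  where open ≤-Reasoning

P[k+a]≤P[a]*p[k+a]^k : ∀ k a → P (k + a) ≤ P a * p (k + a) ^ k
P[k+a]≤P[a]*p[k+a]^k zero a = ≤-reflexive (sym (*-identityʳ (P a)))
P[k+a]≤P[a]*p[k+a]^k (suc k) a = begin
  P (k + a) * q                ≤⟨ *-monoˡ-≤ q (P[k+a]≤P[a]*p[k+a]^k k a) ⟩
  P a * p (k + a) ^ k * q      ≤⟨ *-monoˡ-≤ q (*-monoʳ-≤ (P a) (^-monoˡ-≤ k (p-mono-≤ (n≤1+n (k + a))))) ⟩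
  P a * q ^ k * q              ≡⟨ xy∙z≈x∙zy (P a) (q ^ k) q ⟩
  P a * (q * q ^ k)            ∎
  where
  open ≤-Reasoning
  q = p (suc (k + a))

LeExp-antimono : ∀ {N N′} m → N′ ≤ N → LeExp N m → LeExp N′ m
LeExp-antimono m N′≤N N≤e^m all< = N≤e^m λ k → <-≤-trans (all< k) (*-monoˡ-≤ (k !) N′≤N)

ThetaLe-antimono : ∀ {i j} x → i ≤ j → ThetaLe j x → ThetaLe i x
ThetaLe-antimono x i≤j = LeExp-antimono x (P-mono-≤ i≤j)

LeExp[1] : ∀ m → LeExp 1 m
LeExp[1] m all< = <-irrefl refl (all< 0)

LeExp-witness : ∀ {N m} k → N * k ! ≤ expT m k → LeExp N m
LeExp-witness k reached all< = <⇒≱ (all< k) reached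

bernoulli : ∀ x j → x ^ suc j + suc j * x ^ j ≤ suc x ^ suc j
bernoulli x zero = ≤-reflexive (identity x)
  where identity : ∀ x → x * 1 + 1 * 1 ≡ suc x * 1
        identity = solve-∀
bernoulli x (suc j) = begin
  x * (x * y) + suc (suc j) * (x * y)              ≤⟨ m≤m+n _ (suc j * y) ⟩
  x * (x * y) + suc (suc j) * (x * y) + suc j * y  ≡⟨ identity x j y ⟩
  suc x * (x * y + suc j * y)                      ≤⟨ *-monoʳ-≤ (suc x) (bernoulli x j) ⟩
  suc x * suc x ^ suc j                            ∎
  where
  open ≤-Reasoning
  y = x ^ j
  identity : ∀ x j y → x * (x * y) + suc (suc j) * (x * y) + suc j * y ≡ suc x * (x * y + suc j * y)
  identity = solve-∀

-- S_(k+1)(x) + S_k(x) ≤ S_(k+1)(x+1), termwise by Bernoulli: (x+1)^j/j! ≥ x^j/j! + x^(j-1)/(j-1)!.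
expT[x,1+k]+[1+k]*expT[x,k]≤expT[1+x,1+k] : ∀ x k → expT x (suc k) + suc k * expT x k ≤ expT (suc x) (suc k)
expT[x,1+k]+[1+k]*expT[x,k]≤expT[1+x,1+k] x zero = ≤-reflexive (identity x)
  where identity : ∀ x → (1 * 1 + x * 1) + 1 * 1 ≡ 1 * 1 + suc x * 1
        identity = solve-∀
expT[x,1+k]+[1+k]*expT[x,k]≤expT[1+x,1+k] x (suc k) = begin
  expT x (2 + k) + (2 + k) * expT x (suc k)
    ≡⟨ identity (suc k) (expT x k) (x ^ suc k) (x ^ (2 + k)) ⟩
  (2 + k) * (expT x (suc k) + suc k * expT x k) + (x ^ (2 + k) + (2 + k) * x ^ suc k)
    ≤⟨ +-mono-≤ (*-monoʳ-≤ (2 + k) (expT[x,1+k]+[1+k]*expT[x,k]≤expT[1+x,1+k] x k)) (bernoulli x (suc k)) ⟩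
  expT (suc x) (2 + k) ∎
  where
  open ≤-Reasoning
  identity : ∀ k e y z → (suc k * (k * e + y) + z) + suc k * (k * e + y)
                       ≡ suc k * ((k * e + y) + k * e) + (z + suc k * y)
  identity = solve-∀

2*[1+k]*expT[x,k]≤expT[1+x,1+k] : ∀ x k → 2 * (suc k * expT x k) ≤ expT (suc x) (suc k)
2*[1+k]*expT[x,k]≤expT[1+x,1+k] x k = begin
  2 * (suc k * expT x k)                       ≡⟨ cong (y +_) (+-identityʳ y) ⟩
  y + y                                        ≤⟨ +-monoˡ-≤ y (m≤m+n y (x ^ suc k)) ⟩
  expT x (suc k) + y                           ≤⟨ expT[x,1+k]+[1+k]*expT[x,k]≤expT[1+x,1+k] x k ⟩
  expT (suc x) (suc k)                         ∎
  where
  open ≤-Reasoning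
  y = suc k * expT x k

-- e^(d+x) ≥ 2^d e^x, as e ≥ 2.
LeExp-double : ∀ {N x} d → LeExp N x → LeExp (2 ^ d * N) (d + x)
LeExp-double {N} {x} d N≤e^x all< = N≤e^x below
  where
  reach : ∀ d {k} → N * k ! ≤ expT x k → 2 ^ d * N * (d + k) ! ≤ expT (d + x) (d + k)
  reach zero {k} reached = subst (λ c → c * k ! ≤ expT x k) (sym (+-identityʳ N)) reached
  reach (suc d) {k} reached = begin
    2 * 2 ^ d * N * suc (d + k) !                    ≡⟨ reorder (2 ^ d) N (suc (d + k)) ((d + k) !) ⟩
    2 * (suc (d + k) * (2 ^ d * N * (d + k) !))      ≤⟨ *-monoʳ-≤ 2 (*-monoʳ-≤ (suc (d + k)) (reach d reached)) ⟩
    2 * (suc (d + k) * expT (d + x) (d + k))         ≤⟨ 2*[1+k]*expT[x,k]≤expT[1+x,1+k] (d + x) (d + k) ⟩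
    expT (suc (d + x)) (suc (d + k))                 ∎
    where
    open ≤-Reasoning
    reorder : ∀ t n a b → 2 * t * n * (a * b) ≡ 2 * (a * (t * n * b))
    reorder = solve-∀
  below : ∀ k → expT x k < N * k !
  below k with expT x k <? N * k !
  ... | yes <N*k! = <N*k!
  ... | no ≮N*k! = contradiction (reach d (≮⇒≥ ≮N*k!)) (<⇒≱ (all< (d + k)))

[m*n]^k≡m^k*n^k : ∀ m n k → (m * n) ^ k ≡ m ^ k * n ^ k
[m*n]^k≡m^k*n^k m n zero = refl
[m*n]^k≡m^k*n^k m n (suc k) = begin
  m * n * (m * n) ^ k     ≡⟨ cong (m * n *_) ([m*n]^k≡m^k*n^k m n k) ⟩
  m * n * (m ^ k * n ^ k) ≡⟨ interchange m n (m ^ k) (n ^ k) ⟩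
  m * m ^ k * (n * n ^ k) ∎
  where open ≡-Reasoning

[2m]^j≤[2m]^[2m]*j! : ∀ m j → (2 * m) ^ j ≤ (2 * m) ^ (2 * m) * j !
[2m]^j≤[2m]^[2m]*j! zero zero = ≤-refl
[2m]^j≤[2m]^[2m]*j! zero (suc j) = z≤n
[2m]^j≤[2m]^[2m]*j! (suc m) j with j ≤? 2 * suc m
... | yes j≤2m = ≤-trans (^-monoʳ-≤ (2 * suc m) j≤2m) (m≤m*n _ (j !) {{j !≢0}})
[2m]^j≤[2m]^[2m]*j! (suc m) (suc j) | no j≰2m = begin
  c * c ^ j         ≤⟨ *-monoʳ-≤ c ([2m]^j≤[2m]^[2m]*j! (suc m) j) ⟩
  c * (B * j !)     ≤⟨ *-monoˡ-≤ (B * j !) (≰⇒≥ j≰2m) ⟩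
  suc j * (B * j !) ≡⟨ x∙yz≈y∙xz (suc j) B (j !) ⟩
  B * (suc j * j !) ∎
  where
  open ≤-Reasoning
  c = 2 * suc m
  B = c ^ c
[2m]^j≤[2m]^[2m]*j! (suc m) zero | no 0≰2m = contradiction z≤n 0≰2m

-- Each term m^j/j! is at most (2m)^(2m)/2^j, so the partial sums stay below 2 (2m)^(2m).
expT<2*[2m]^[2m]*k! : ∀ m k → expT m k < 2 * (2 * m) ^ (2 * m) * k !
expT<2*[2m]^[2m]*k! m k = *-cancelˡ-< (2 ^ k) _ _ (begin-strict
  2 ^ k * expT m k                  <⟨ m<m+n _ (*-mono-≤ 1≤B (1≤n! k)) ⟩
  2 ^ k * expT m k + B * k !        ≤⟨ invariant k ⟩
  2 * 2 ^ k * B * k !               ≡⟨ reorder (2 ^ k) B (k !) ⟩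
  2 ^ k * (2 * B * k !)             ∎)
  where
  open ≤-Reasoning
  B = (2 * m) ^ (2 * m)
  reorder : ∀ t b f → 2 * t * b * f ≡ t * (2 * b * f)
  reorder = solve-∀
  1≤B : 1 ≤ B
  1≤B = 1≤[2m]^[2m] m
    where 1≤[2m]^[2m] : ∀ m → 1 ≤ (2 * m) ^ (2 * m)
          1≤[2m]^[2m] zero = ≤-refl
          1≤[2m]^[2m] (suc m) = m^n>0 (2 * suc m) (2 * suc m)
  invariant : ∀ k → 2 ^ k * expT m k + B * k ! ≤ 2 * 2 ^ k * B * k !
  invariant zero = begin
    1 * 1 + B * 1     ≡⟨ cong₂ _+_ refl (*-identityʳ B) ⟩
    1 + B             ≤⟨ +-monoˡ-≤ B 1≤B ⟩
    B + B             ≡⟨ double B ⟩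
    2 * 1 * B * 1     ∎
    where double : ∀ b → b + b ≡ 2 * 1 * b * 1
          double = solve-∀
  invariant (suc k) = begin
    2 * t * (suc k * e + x) + B * (suc k * f)
      ≡⟨ expand t (suc k) e x B f ⟩
    2 * suc k * (t * e) + (2 * t) * x + B * (suc k * f)
      ≤⟨ +-monoˡ-≤ (B * (suc k * f)) (+-monoʳ-≤ (2 * suc k * (t * e)) term-bound) ⟩
    2 * suc k * (t * e) + B * (suc k * f) + B * (suc k * f)
      ≡⟨ collect t (suc k) e B f ⟩
    2 * suc k * (t * e + B * f)
      ≤⟨ *-monoʳ-≤ (2 * suc k) (invariant k) ⟩
    2 * suc k * (2 * t * B * f)
      ≡⟨ reassoc t (suc k) B f ⟩
    2 * (2 * t) * B * (suc k * f) ∎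
    where
    t = 2 ^ k
    e = expT m k
    x = m ^ suc k
    f = k !
    term-bound : 2 * t * x ≤ B * (suc k * f)
    term-bound = subst (_≤ B * (suc k * f)) ([m*n]^k≡m^k*n^k 2 m (suc k)) ([2m]^j≤[2m]^[2m]*j! m (suc k))
    expand : ∀ t s e x b f → 2 * t * (s * e + x) + b * (s * f) ≡ 2 * s * (t * e) + (2 * t) * x + b * (s * f)
    expand = solve-∀
    collect : ∀ t s e b f → 2 * s * (t * e) + b * (s * f) + b * (s * f) ≡ 2 * s * (t * e + b * f)
    collect = solve-∀
    reassoc : ∀ t s b f → 2 * s * (2 * t * b * f) ≡ 2 * (2 * t) * b * (s * f)
    reassoc = solve-∀

LeExp⇒<2*[2m]^[2m] : ∀ {N} m → LeExp N m → N < 2 * (2 * m) ^ (2 * m)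
LeExp⇒<2*[2m]^[2m] {N} m N≤e^m with N <? 2 * (2 * m) ^ (2 * m)
... | yes N<bound = N<bound
... | no N≮bound = contradiction (λ k → <-≤-trans (expT<2*[2m]^[2m]*k! m k) (*-monoˡ-≤ (k !) (≮⇒≥ N≮bound))) N≤e^m

-- expTail m K / (K+1)! = S_K + 2 m^(K+1)/(K+1)!; once consecutive terms of the series shrink
-- by a factor 2, the geometric tail shows that it bounds every partial sum S_k.
expTail : ℕ → ℕ → ℕ
expTail m K = suc K * expT m K + 2 * m ^ suc K

expTail-step : ∀ m k → 2 * m ≤ 2 + k → expTail m (suc k) ≤ (2 + k) * expTail m k
expTail-step m k 2m≤2+k = begin
  (2 + k) * (suc k * e + x) + 2 * (m * x)            ≡⟨ expand (2 + k) (suc k) e x m ⟩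
  (2 + k) * (suc k * e) + (2 + k) * x + (2 * m) * x  ≤⟨ +-monoʳ-≤ ((2 + k) * (suc k * e) + (2 + k) * x) (*-monoˡ-≤ x 2m≤2+k) ⟩
  (2 + k) * (suc k * e) + (2 + k) * x + (2 + k) * x  ≡⟨ collect (2 + k) (suc k) e x ⟩
  (2 + k) * (suc k * e + 2 * x)                      ∎
  where
  open ≤-Reasoning
  e = expT m k
  x = m ^ suc k
  expand : ∀ a b e x m → a * (b * e + x) + 2 * (m * x) ≡ a * (b * e) + a * x + (2 * m) * x
  expand = solve-∀
  collect : ∀ a b e x → a * (b * e) + a * x + a * x ≡ a * (b * e + 2 * x)
  collect = solve-∀

expTail-antitone : ∀ m K → 2 * m ≤ 2 + K → ∀ j → expTail m (j + K) * suc K ! ≤ expTail m K * suc (j + K) !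
expTail-antitone m K 2m≤2+K zero = ≤-refl
expTail-antitone m K 2m≤2+K (suc j) = begin
  expTail m (suc (j + K)) * suc K !            ≤⟨ *-monoˡ-≤ (suc K !) (expTail-step m (j + K) (≤-trans 2m≤2+K (+-monoʳ-≤ 2 (m≤n+m K j)))) ⟩
  (2 + (j + K)) * expTail m (j + K) * suc K !  ≡⟨ *-assoc (2 + (j + K)) (expTail m (j + K)) (suc K !) ⟩
  (2 + (j + K)) * (expTail m (j + K) * suc K !) ≤⟨ *-monoʳ-≤ (2 + (j + K)) (expTail-antitone m K 2m≤2+K j) ⟩
  (2 + (j + K)) * (expTail m K * suc (j + K) !) ≡⟨ x∙yz≈y∙xz (2 + (j + K)) (expTail m K) (suc (j + K) !) ⟩
  expTail m K * suc (suc (j + K)) !            ∎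
  where open ≤-Reasoning

expT-mono : ∀ m k j → expT m k * (j + k) ! ≤ expT m (j + k) * k !
expT-mono m k zero = ≤-refl
expT-mono m k (suc j) = begin
  expT m k * (suc (j + k) * (j + k) !)  ≡⟨ x∙yz≈y∙xz (expT m k) (suc (j + k)) ((j + k) !) ⟩
  suc (j + k) * (expT m k * (j + k) !)  ≤⟨ *-monoʳ-≤ (suc (j + k)) (expT-mono m k j) ⟩
  suc (j + k) * (expT m (j + k) * k !)  ≡⟨ *-assoc (suc (j + k)) (expT m (j + k)) (k !) ⟨
  suc (j + k) * expT m (j + k) * k !    ≤⟨ *-monoˡ-≤ (k !) (m≤m+n (suc (j + k) * expT m (j + k)) (m ^ suc (j + k))) ⟩
  expT m (suc (j + k)) * k !            ∎
  where open ≤-Reasoning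

expT≤expTail : ∀ m K → 2 * m ≤ 2 + K → ∀ k → expT m k * suc K ! ≤ expTail m K * k !
expT≤expTail m K 2m≤2+K k with ≤-total k K
... | inj₁ k≤K = below (K ∸ k) (sym (m∸n+n≡m k≤K))
  where
  below : ∀ j → K ≡ j + k → expT m k * suc K ! ≤ expTail m K * k !
  below j refl = begin
    expT m k * (suc K * K !)  ≡⟨ x∙yz≈y∙xz (expT m k) (suc K) (K !) ⟩
    suc K * (expT m k * K !)  ≤⟨ *-monoʳ-≤ (suc K) (expT-mono m k j) ⟩
    suc K * (expT m K * k !)  ≡⟨ *-assoc (suc K) (expT m K) (k !) ⟨
    suc K * expT m K * k !    ≤⟨ *-monoˡ-≤ (k !) (m≤m+n (suc K * expT m K) (2 * m ^ suc K)) ⟩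
    expTail m K * k !         ∎
    where open ≤-Reasoning
... | inj₂ K≤k = above (k ∸ K) (sym (m∸n+n≡m K≤k))
  where
  above : ∀ j → k ≡ j + K → expT m k * suc K ! ≤ expTail m K * k !
  above j refl = *-cancelˡ-≤ (suc k) (begin
    suc k * (expT m k * suc K !)  ≡⟨ *-assoc (suc k) (expT m k) (suc K !) ⟨
    suc k * expT m k * suc K !    ≤⟨ *-monoˡ-≤ (suc K !) (m≤m+n (suc k * expT m k) (2 * m ^ suc k)) ⟩
    expTail m k * suc K !         ≤⟨ expTail-antitone m K 2m≤2+K j ⟩
    expTail m K * (suc k * k !)   ≡⟨ x∙yz≈y∙xz (expTail m K) (suc k) (k !) ⟩
    suc k * (expTail m K * k !)   ∎)
    where open ≤-Reasoning

¬LeExp-by-tail : ∀ {N} m K → 2 * m ≤ 2 + K → expTail m K < N * suc K ! → ¬ LeExp N m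
¬LeExp-by-tail {N} m K 2m≤2+K tail<N N≤e^m = N≤e^m λ k → *-cancelʳ-< (suc K !) _ _ (begin-strict
  expT m k * suc K !    ≤⟨ expT≤expTail m K 2m≤2+K k ⟩
  expTail m K * k !     <⟨ *-monoˡ-< (k !) {{k !≢0}} tail<N ⟩
  N * suc K ! * k !     ≡⟨ xy∙z≈xz∙y N (suc K !) (k !) ⟩
  N * k ! * suc K !     ∎)
  where open ≤-Reasoning

Unique-⊆⇒length≤ : ∀ {ℓ} {A : Set ℓ} {xs ys : List A} → Unique xs → xs ⊆ ys → length xs ≤ length ys
Unique-⊆⇒length≤ {xs = []} _ _ = z≤n
Unique-⊆⇒length≤ {xs = x ∷ xs} (x∉xs ∷ unique) x∷xs⊆ys with us , vs , refl ← ∈-∃++ (x∷xs⊆ys (here refl)) = begin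
  suc (length xs)             ≤⟨ s≤s (Unique-⊆⇒length≤ unique xs⊆us++vs) ⟩
  suc (length (us ++ vs))     ≡⟨ cong suc (length-++ us) ⟩
  suc (length us + length vs) ≡⟨ +-suc (length us) (length vs) ⟨
  length us + length (x ∷ vs) ≡⟨ length-++ us ⟨
  length (us ++ x ∷ vs)       ∎
  where
  open ≤-Reasoning
  xs⊆us++vs : xs ⊆ us ++ vs
  xs⊆us++vs y∈xs with ∈-++⁻ us (x∷xs⊆ys (there y∈xs))
  ... | inj₁ y∈us = ∈-++⁺ˡ y∈us
  ... | inj₂ (here refl) = contradiction refl (All.lookup x∉xs y∈xs)
  ... | inj₂ (there y∈vs) = ∈-++⁺ʳ us y∈vs

count≤ : ∀ {x c} A → PiThetaIs x c → ¬ ThetaLe (suc A) x → c ≤ A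
count≤ {x} A (L , unique , members , refl) ¬θ[1+A] =
  subst (length L ≤_) (length-applyUpTo suc A) (Unique-⊆⇒length≤ unique L⊆[1,A])
  where
  L⊆[1,A] : L ⊆ applyUpTo suc A
  L⊆[1,A] {i} i∈L with Equivalence.to (members i) i∈L
  ... | s≤s z≤n , θi with i ≤? A
  ...   | yes i≤A = ∈-applyUpTo⁺ suc i≤A
  ...   | no i≰A = contradiction (ThetaLe-antimono x (≰⇒> i≰A) θi) ¬θ[1+A]

≤count : ∀ {x c} M → PiThetaIs x c → ThetaLe M x → M ≤ c
≤count {x} M (L , unique , members , refl) θM =
  subst (_≤ length L) (length-applyUpTo suc M) (Unique-⊆⇒length≤ [1,M]-unique [1,M]⊆L)
  where
  [1,M]-unique : Unique (applyUpTo suc M)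
  [1,M]-unique = applyUpTo⁺₁ suc M λ i<j _ i+1≡j+1 → <-irrefl (suc-injective i+1≡j+1) i<j
  [1,M]⊆L : applyUpTo suc M ⊆ L
  [1,M]⊆L i∈[1,M] with j , j<M , refl ← ∈-applyUpTo⁻ suc i∈[1,M] =
    Equivalence.from (members (suc j)) (s≤s z≤n , ThetaLe-antimono x j<M θM)

count-ThetaLe : ∀ {x c} → PiThetaIs x c → ThetaLe c x
count-ThetaLe {x} {zero} _ = LeExp[1] x
count-ThetaLe {x} {suc c} count all< = <-irrefl refl (count≤ c count λ θ[1+c] → θ[1+c] all<)

-- Chebyshev's lower bound for π

pascal : ∀ n k → suc n C suc k ≡ n C k + n C suc k
pascal n k = sym (nCk+nC[k+1]≡[n+1]C[k+1] n k)

0<nCk : ∀ {n k} → k ≤ n → 0 < n C k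
0<nCk {k = zero} _ = s≤s z≤n
0<nCk {suc n} {suc k} (s≤s k≤n) rewrite pascal n k = <-≤-trans (0<nCk k≤n) (m≤m+n _ _)

nCk≤[1+n]Ck : ∀ n k → n C k ≤ suc n C k
nCk≤[1+n]Ck n zero = ≤-refl
nCk≤[1+n]Ck n (suc k) rewrite pascal n k = m≤n+m _ _

nCk≤[1+n]C[1+k] : ∀ n k → n C k ≤ suc n C suc k
nCk≤[1+n]C[1+k] n k rewrite pascal n k = m≤m+n _ _

[1+k]*[1+n]C[1+k]≡[1+n]*nCk : ∀ n k → suc k * (suc n C suc k) ≡ suc n * (n C k)
[1+k]*[1+n]C[1+k]≡[1+n]*nCk zero zero = refl
[1+k]*[1+n]C[1+k]≡[1+n]*nCk zero (suc k) = *-zeroʳ (2 + k)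
[1+k]*[1+n]C[1+k]≡[1+n]*nCk (suc n) zero = trans (+-identityʳ _) (trans (nC1≡n (2 + n)) (sym (*-identityʳ (2 + n))))
[1+k]*[1+n]C[1+k]≡[1+n]*nCk (suc n) (suc k) = begin
  (2 + k) * ((2 + n) C (2 + k))
    ≡⟨ cong ((2 + k) *_) (pascal (suc n) (suc k)) ⟩
  (2 + k) * (c + suc n C (2 + k))
    ≡⟨ distribute (suc k) c (suc n C (2 + k)) ⟩
  c + suc k * c + (2 + k) * (suc n C (2 + k))
    ≡⟨ cong₂ (λ x y → c + x + y) ([1+k]*[1+n]C[1+k]≡[1+n]*nCk n k) ([1+k]*[1+n]C[1+k]≡[1+n]*nCk n (suc k)) ⟩
  c + suc n * (n C k) + suc n * (n C suc k)
    ≡⟨ factor c (suc n) (n C k) (n C suc k) ⟩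
  c + suc n * (n C k + n C suc k)
    ≡⟨ cong (λ x → c + suc n * x) (pascal n k) ⟨
  (2 + n) * c ∎
  where
  open ≡-Reasoning
  c = suc n C suc k
  distribute : ∀ k a b → suc k * (a + b) ≡ a + k * a + suc k * b
  distribute = solve-∀
  factor : ∀ c m a b → c + m * a + m * b ≡ c + m * (a + b)
  factor = solve-∀

2^n≤[n+n]Cn : ∀ n → 2 ^ n ≤ (n + n) C n
2^n≤[n+n]Cn zero = ≤-refl
2^n≤[n+n]Cn (suc n) = begin
  2 * 2 ^ n                              ≤⟨ *-monoʳ-≤ 2 (2^n≤[n+n]Cn n) ⟩
  2 * c                                  ≡⟨ cong (c +_) (+-identityʳ c) ⟩
  c + c                                  ≤⟨ +-mono-≤ (nCk≤[1+n]Ck (n + n) n) (nCk≤[1+n]C[1+k] (n + n) n) ⟩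
  suc (n + n) C n + suc (n + n) C suc n  ≡⟨ pascal (suc (n + n)) n ⟨
  suc (suc (n + n)) C suc n              ≡⟨ cong (λ m → suc m C suc n) (+-suc n n) ⟨
  (suc n + suc n) C suc n                ∎
  where
  open ≤-Reasoning
  c = (n + n) C n

lcmUpTo : ℕ → ℕ
lcmUpTo zero = 1
lcmUpTo (suc N) = lcm (lcmUpTo N) (suc N)

lcm-nonZero : ∀ m n → .{{NonZero m}} → .{{NonZero n}} → NonZero (lcm m n)
lcm-nonZero m n = ≢-nonZero λ lcm≡0 → [ ≢-nonZero⁻¹ m , ≢-nonZero⁻¹ n ]′
  (m*n≡0⇒m≡0∨n≡0 m (trans (sym (gcd*lcm m n)) (trans (cong (gcd m n *_) lcm≡0) (*-zeroʳ (gcd m n)))))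

lcmUpTo-nonZero : ∀ N → NonZero (lcmUpTo N)
lcmUpTo-nonZero zero = _
lcmUpTo-nonZero (suc N) = lcm-nonZero (lcmUpTo N) (suc N) {{lcmUpTo-nonZero N}}

lcmUpTo∣lcmUpTo[1+N] : ∀ N → lcmUpTo N ∣ lcmUpTo (suc N)
lcmUpTo∣lcmUpTo[1+N] N = m∣lcm[m,n] (lcmUpTo N) (suc N)

∣lcmUpTo : ∀ {m} N → 1 ≤ m → m ≤ N → m ∣ lcmUpTo N
∣lcmUpTo zero 1≤m m≤0 = contradiction (≤-trans 1≤m m≤0) λ ()
∣lcmUpTo {m} (suc N) 1≤m m≤1+N with m≤n⇒m<n∨m≡n m≤1+N
... | inj₂ refl = n∣lcm[m,n] (lcmUpTo N) (suc N)
... | inj₁ (s≤s m≤N) = ∣-trans (∣lcmUpTo N 1≤m m≤N) (lcmUpTo∣lcmUpTo[1+N] N)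

-- 1/X = 1/Z - 1/Y, so L/X = L/Z - L/Y is an integer.
harmonic-∣ : ∀ {X Y Z L} → .{{NonZero (Y * Z)}} → X * Y ≡ Y * Z + X * Z → Z ∣ L → Y ∣ L → X ∣ L
harmonic-∣ {X} {Y} {Z} {L} XY≡YZ+XZ (divides u L≡uZ) (divides v L≡vY) =
  ∣m+n∣m⇒∣n (subst (X ∣_) (trans Xu≡L+Xv (+-comm L (X * v))) (m∣m*n u)) (m∣m*n v)
  where
  open ≡-Reasoning
  Xu≡L+Xv : X * u ≡ L + X * v
  Xu≡L+Xv = *-cancelʳ-≡ (X * u) (L + X * v) (Y * Z) (begin
    X * u * (Y * Z)               ≡⟨ regroup X u Y Z ⟩
    X * Y * (u * Z)               ≡⟨ cong (X * Y *_) L≡uZ ⟨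
    X * Y * L                     ≡⟨ cong (_* L) XY≡YZ+XZ ⟩
    (Y * Z + X * Z) * L           ≡⟨ *-distribʳ-+ L (Y * Z) (X * Z) ⟩
    Y * Z * L + X * Z * L         ≡⟨ cong (λ l → Y * Z * L + X * Z * l) L≡vY ⟩
    Y * Z * L + X * Z * (v * Y)   ≡⟨ collect L Y Z X v ⟩
    (L + X * v) * (Y * Z)         ∎)
    where
    regroup : ∀ x u y z → x * u * (y * z) ≡ x * y * (u * z)
    regroup = solve-∀
    collect : ∀ l y z x v → y * z * l + x * z * (v * y) ≡ (l + x * v) * (y * z)
    collect = solve-∀

k*NCk∣lcmUpTo : ∀ {k N} → 1 ≤ k → k ≤ N → k * (N C k) ∣ lcmUpTo N
k*NCk∣lcmUpTo {suc zero} {N} _ 1≤N = subst (_∣ lcmUpTo N) (sym (trans (+-identityʳ _) (nC1≡n N))) (∣lcmUpTo N 1≤N ≤-refl)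
k*NCk∣lcmUpTo {suc (suc k)} {suc N} _ (s≤s 1+k≤N) =
  harmonic-∣ {{YZ≢0}} leibniz
    (∣-trans (k*NCk∣lcmUpTo (s≤s z≤n) 1+k≤N) (lcmUpTo∣lcmUpTo[1+N] N))
    (k*NCk∣lcmUpTo (s≤s z≤n) (m≤n⇒m≤1+n 1+k≤N))
  where
  a = N C k
  b = N C suc k
  X = (2 + k) * (suc N C (2 + k))
  Y = suc k * (suc N C suc k)
  Z = suc k * b
  YZ≢0 : NonZero (Y * Z)
  YZ≢0 = m*n≢0 Y Z {{m*n≢0 (suc k) _ {{_}} {{>-nonZero (0<nCk (m≤n⇒m≤1+n 1+k≤N))}}}}
                   {{m*n≢0 (suc k) b {{_}} {{>-nonZero (0<nCk 1+k≤N)}}}}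
  X≡[1+N]*b : X ≡ suc N * b
  X≡[1+N]*b = [1+k]*[1+n]C[1+k]≡[1+n]*nCk N (suc k)
  Y≡[1+N]*a : Y ≡ suc N * a
  Y≡[1+N]*a = [1+k]*[1+n]C[1+k]≡[1+n]*nCk N k
  leibniz : X * Y ≡ Y * Z + X * Z
  leibniz = begin
    X * Y                               ≡⟨ cong₂ _*_ X≡[1+N]*b Y≡[1+N]*a ⟩
    (suc N * b) * (suc N * a)           ≡⟨ cong (suc N * b *_) Y≡[1+N]*a ⟨
    (suc N * b) * (suc k * (suc N C suc k)) ≡⟨ cong (λ c → suc N * b * (suc k * c)) (pascal N k) ⟩
    (suc N * b) * (suc k * (a + b))     ≡⟨ expand (suc N) (suc k) a b ⟩
    (suc N * a) * Z + (suc N * b) * Z   ≡⟨ cong₂ (λ y x → y * Z + x * Z) Y≡[1+N]*a X≡[1+N]*b ⟨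
    Y * Z + X * Z                       ∎
    where
    open ≡-Reasoning
    expand : ∀ n k a b → (n * b) * (k * (a + b)) ≡ (n * a) * (k * b) + (n * b) * (k * b)
    expand = solve-∀

splitPower : ∀ {q} → Prime q → ∀ m → .{{NonZero m}} → ∃[ e ] ∃[ r ] m ≡ q ^ e * r × ¬ q ∣ r
splitPower {q} q-prime m = go m (<-wellFounded m)
  where
  instance _ = prime⇒nonTrivial q-prime
  go : ∀ m → .{{NonZero m}} → Acc _<_ m → ∃[ e ] ∃[ r ] m ≡ q ^ e * r × ¬ q ∣ r
  go m (acc smaller) with q ∣? m
  ... | no q∤m = 0 , m , sym (+-identityʳ m) , q∤m
  ... | yes q∣m with e , r , m/q≡qᵉr , q∤r ← go (quotient q∣m) {{quotient≢0 q∣m}} (smaller (quotient-< q∣m)) =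
    suc e , r , trans (m∣n⇒n≡m*quotient q∣m) (trans (cong (q *_) m/q≡qᵉr) (sym (*-assoc q (q ^ e) r))) , q∤r

prime∣prime^e⇒≡ : ∀ {q s} → Prime q → Prime s → ∀ e → s ∣ q ^ e → s ≡ q
prime∣prime^e⇒≡ q-prime s-prime zero s∣1 = contradiction (subst Prime (∣1⇒≡1 s∣1) s-prime) ¬prime[1]
prime∣prime^e⇒≡ {q} q-prime s-prime (suc e) s∣qᵉ⁺¹ with euclidsLemma q (q ^ e) s-prime s∣qᵉ⁺¹
... | inj₂ s∣qᵉ = prime∣prime^e⇒≡ q-prime s-prime e s∣qᵉ
... | inj₁ s∣q with prime⇒irreducible q-prime s∣q
...   | inj₁ refl = contradiction s-prime ¬prime[1]
...   | inj₂ s≡q = s≡q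

coprime-prime^e : ∀ {q r} → Prime q → ¬ q ∣ r → ∀ e → Coprime (q ^ e) r
coprime-prime^e {q} q-prime q∤r e {zero} (_ , 0∣r) = contradiction (subst (q ∣_) (sym (0∣⇒≡0 0∣r)) (q ∣0)) q∤r
coprime-prime^e q-prime q∤r e {suc zero} _ = refl
coprime-prime^e q-prime q∤r e {d@(suc (suc _))} (d∣qᵉ , d∣r) with s , s-prime , s∣d ← primeDivisor d (s≤s (s≤s z≤n)) =
  contradiction (subst (_∣ _) (prime∣prime^e⇒≡ q-prime s-prime e (∣-trans s∣d d∣qᵉ)) (∣-trans s∣d d∣r)) q∤r

coprime-∣⇒*-∣ : ∀ {a b c} → Coprime a b → a ∣ c → b ∣ c → a * b ∣ c
coprime-∣⇒*-∣ {a} {b} {c} coprime a∣c b∣c = subst (_∣ c) lcm≡a*b (lcm-least a∣c b∣c)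
  where
  lcm≡a*b : lcm a b ≡ a * b
  lcm≡a*b = trans (sym (*-identityˡ (lcm a b))) (trans (cong (_* lcm a b) (sym (coprime⇒gcd≡1 coprime))) (gcd*lcm a b))

proper-factor≤ : ∀ {N a b} → .{{NonZero a}} → suc N ≡ a * b → 1 < b → a ≤ N
proper-factor≤ {a = a} {b} N+1≡ab 1<b = ≤-pred (subst (a <_) (sym N+1≡ab) (m<m*n a b 1<b))

-- Writing N+1 = q^e r with q ∤ r: if r > 1 then q^e and r are coprime and both at most N.
primePower⊎∣lcmUpTo : ∀ N → 1 ≤ N → (∃[ q ] ∃[ e ] Prime q × suc N ≡ q ^ suc e) ⊎ suc N ∣ lcmUpTo N
primePower⊎∣lcmUpTo N 1≤N with primeDivisor (suc N) (s≤s 1≤N)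
... | q , q-prime , q∣N+1 with splitPower q-prime (suc N)
...   | zero , r , N+1≡r , q∤r = contradiction (subst (q ∣_) (trans N+1≡r (+-identityʳ r)) q∣N+1) q∤r
...   | suc e , zero , N+1≡0 , q∤r = contradiction (q ∣0) q∤r
...   | suc e , suc zero , N+1≡qᵉ⁺¹ , _ = inj₁ (q , e , q-prime , trans N+1≡qᵉ⁺¹ (*-identityʳ _))
...   | suc e , r@(suc (suc _)) , N+1≡qᵉ⁺¹r , q∤r =
  inj₂ (subst (_∣ lcmUpTo N) (sym N+1≡qᵉ⁺¹r) (coprime-∣⇒*-∣ (coprime-prime^e q-prime q∤r (suc e)) qᵉ⁺¹∣L r∣L))
  where
  instance _ = prime⇒nonZero q-prime
  qᵉ⁺¹ = q ^ suc e
  instance _ = m^n≢0 q (suc e)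
  1<qᵉ⁺¹ : 1 < qᵉ⁺¹
  1<qᵉ⁺¹ = <-≤-trans (prime⇒2≤ q-prime) (m≤m*n q (q ^ e) {{m^n≢0 q e}})
  qᵉ⁺¹∣L : qᵉ⁺¹ ∣ lcmUpTo N
  qᵉ⁺¹∣L = ∣lcmUpTo N (m^n>0 q (suc e)) (proper-factor≤ N+1≡qᵉ⁺¹r (s≤s (s≤s z≤n)))
  r∣L : r ∣ lcmUpTo N
  r∣L = ∣lcmUpTo N (s≤s z≤n) (proper-factor≤ (trans N+1≡qᵉ⁺¹r (*-comm qᵉ⁺¹ r)) 1<qᵉ⁺¹)

-- ilog q N = ⌊log_q N⌋ for q ≥ 2 and N ≥ 1.
ilog : ℕ → ℕ → ℕ
ilog q zero = 0
ilog q (suc N) with q ^ suc (ilog q N) ≤? suc N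
... | yes _ = suc (ilog q N)
... | no  _ = ilog q N

ilog-bounds : ∀ {q} → 2 ≤ q → ∀ N → q ^ ilog q (suc N) ≤ suc N × suc N < q ^ suc (ilog q (suc N))
ilog-bounds {q} 2≤q zero with q ^ suc (ilog q zero) ≤? 1
... | yes q≤1 = contradiction (≤-trans 2≤q (subst (_≤ 1) (*-identityʳ q) q≤1)) λ { (s≤s ()) }
... | no  _ = ≤-refl , subst (1 <_) (sym (*-identityʳ q)) 2≤q
ilog-bounds {q} 2≤q (suc N) with ilog-bounds 2≤q N | q ^ suc (ilog q (suc N)) ≤? suc (suc N)
... | _ , N+1<Q | yes Q≤N+2 = Q≤N+2 , (begin-strict
  suc (suc N) ≤⟨ N+1<Q ⟩
  Q           <⟨ m<m*n Q q {{m^n≢0 q (suc (ilog q (suc N))) {{q≢0}}}} 2≤q ⟩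
  Q * q       ≡⟨ *-comm Q q ⟩
  q * Q       ∎)
  where
  open ≤-Reasoning
  q≢0 = >-nonZero (<-trans (s≤s z≤n) 2≤q)
  Q = q ^ suc (ilog q (suc N))
... | qˡ≤N+1 , _ | no Q≰N+2 = m≤n⇒m≤1+n qˡ≤N+1 , ≰⇒> Q≰N+2

ilog-mono : ∀ q N → ilog q N ≤ ilog q (suc N)
ilog-mono q N with q ^ suc (ilog q N) ≤? suc N
... | yes _ = n≤1+n _
... | no  _ = ≤-refl

ilog-at-power : ∀ {q N e} → 2 ≤ q → suc (suc N) ≡ q ^ suc e → ilog q (suc (suc N)) ≡ suc (ilog q (suc N))
ilog-at-power {q} {N} {e} 2≤q N+2≡qᵉ⁺¹ with q ^ suc (ilog q (suc N)) ≤? suc (suc N)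
... | yes _ = refl
... | no Q≰N+2 = contradiction (≤-trans (^-monoʳ-≤ q l<e+1) (≤-reflexive (sym N+2≡qᵉ⁺¹))) Q≰N+2
  where
  instance _ = >-nonZero (<-trans (s≤s z≤n) 2≤q)
  l = ilog q (suc N)
  l<e+1 : l < suc e
  l<e+1 = ≰⇒> λ e+1≤l → <-irrefl refl (begin-strict
    q ^ l       ≤⟨ proj₁ (ilog-bounds 2≤q N) ⟩
    suc N       <⟨ n<1+n (suc N) ⟩
    suc (suc N) ≡⟨ N+2≡qᵉ⁺¹ ⟩
    q ^ suc e   ≤⟨ ^-monoʳ-≤ q e+1≤l ⟩
    q ^ l       ∎)
    where open ≤-Reasoning

-- ∏ q^⌊log_q N⌋ over the primes q ≤ B; for B ≥ N this is lcmUpTo N.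
primePowerProduct : ℕ → ℕ → ℕ
primePowerProduct zero N = 1
primePowerProduct (suc B) N with prime? (suc B)
... | yes _ = primePowerProduct B N * suc B ^ ilog (suc B) N
... | no  _ = primePowerProduct B N

primePowerProduct-positive : ∀ B N → 1 ≤ primePowerProduct B N
primePowerProduct-positive zero N = ≤-refl
primePowerProduct-positive (suc B) N with prime? (suc B)
... | yes _ = *-mono-≤ (primePowerProduct-positive B N) (m^n>0 (suc B) (ilog (suc B) N))
... | no  _ = primePowerProduct-positive B N

primePowerProduct-mono : ∀ B N → primePowerProduct B N ≤ primePowerProduct B (suc N)
primePowerProduct-mono zero N = ≤-refl
primePowerProduct-mono (suc B) N with prime? (suc B)
... | yes _ = *-mono-≤ (primePowerProduct-mono B N) (^-monoʳ-≤ (suc B) (ilog-mono (suc B) N))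
... | no  _ = primePowerProduct-mono B N

primePowerProduct-step : ∀ {q} B N → Prime q → q ≤ B → ilog q (suc N) ≡ suc (ilog q N) →
                         q * primePowerProduct B N ≤ primePowerProduct B (suc N)
primePowerProduct-step zero N q-prime q≤0 _ = contradiction (≤-trans (prime⇒2≤ q-prime) q≤0) λ ()
primePowerProduct-step {q} (suc B) N q-prime q≤B+1 ilog-jumps with prime? (suc B) | m≤n⇒m<n∨m≡n q≤B+1
... | no ¬q-prime | inj₂ refl = contradiction q-prime ¬q-prime
... | no  _       | inj₁ (s≤s q≤B) = primePowerProduct-step B N q-prime q≤B ilog-jumps
... | yes _       | inj₂ refl = begin
  q * (G N * q ^ ilog q N)     ≡⟨ x∙yz≈y∙xz q (G N) (q ^ ilog q N) ⟩
  G N * (q * q ^ ilog q N)     ≤⟨ *-monoˡ-≤ _ (primePowerProduct-mono B N) ⟩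
  G (suc N) * q ^ suc (ilog q N) ≡⟨ cong (λ l → G (suc N) * q ^ l) ilog-jumps ⟨
  G (suc N) * q ^ ilog q (suc N) ∎
  where
  open ≤-Reasoning
  G = primePowerProduct B
... | yes _       | inj₁ (s≤s q≤B) = begin
  q * (G N * Q N)              ≡⟨ *-assoc q (G N) (Q N) ⟨
  q * G N * Q N                ≤⟨ *-mono-≤ (primePowerProduct-step B N q-prime q≤B ilog-jumps) (^-monoʳ-≤ (suc B) (ilog-mono (suc B) N)) ⟩
  G (suc N) * Q (suc N)        ∎
  where
  open ≤-Reasoning
  G = primePowerProduct B
  Q = λ N → suc B ^ ilog (suc B) N

primePowerProduct≤ : ∀ B N → primePowerProduct B (suc N) ≤ suc N ^ primeCount B
primePowerProduct≤ zero N = ≤-refl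
primePowerProduct≤ (suc B) N with prime? (suc B)
... | yes B+1-prime = begin
  primePowerProduct B (suc N) * suc B ^ ilog (suc B) (suc N)
    ≤⟨ *-mono-≤ (primePowerProduct≤ B N) (proj₁ (ilog-bounds (prime⇒2≤ B+1-prime) N)) ⟩
  suc N ^ primeCount B * suc N ≡⟨ *-comm _ (suc N) ⟩
  suc N ^ suc (primeCount B)   ∎
  where open ≤-Reasoning
... | no _ = primePowerProduct≤ B N

-- Passing from N to N+1 the lcm is unchanged unless N+1 = q^(e+1), when it gains a factor q.
lcmUpTo≤primePowerProduct : ∀ B N → suc N ≤ B → lcmUpTo (suc N) ≤ primePowerProduct B (suc N)
lcmUpTo≤primePowerProduct B zero _ = ≤-trans (∣⇒≤ (lcm-least {1} ∣-refl ∣-refl)) (primePowerProduct-positive B 1)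
lcmUpTo≤primePowerProduct B (suc N) N+2≤B with primePower⊎∣lcmUpTo (suc N) (s≤s z≤n)
... | inj₂ N+2∣L = begin
  lcmUpTo (2 + N)               ≤⟨ ∣⇒≤ {{lcmUpTo-nonZero (suc N)}} (lcm-least ∣-refl N+2∣L) ⟩
  lcmUpTo (suc N)               ≤⟨ lcmUpTo≤primePowerProduct B N (<⇒≤ N+2≤B) ⟩
  primePowerProduct B (suc N)   ≤⟨ primePowerProduct-mono B (suc N) ⟩
  primePowerProduct B (2 + N)   ∎
  where open ≤-Reasoning
... | inj₁ (q , e , q-prime , N+2≡qᵉ⁺¹) = begin
  lcmUpTo (2 + N)               ≤⟨ ∣⇒≤ {{m*n≢0 q (lcmUpTo (suc N)) {{prime⇒nonZero q-prime}} {{lcmUpTo-nonZero (suc N)}}}} (lcm-least (n∣m*n q) N+2∣qL) ⟩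
  q * lcmUpTo (suc N)           ≤⟨ *-monoʳ-≤ q (lcmUpTo≤primePowerProduct B N (<⇒≤ N+2≤B)) ⟩
  q * primePowerProduct B (suc N) ≤⟨ primePowerProduct-step B (suc N) q-prime q≤B (ilog-at-power {e = e} (prime⇒2≤ q-prime) N+2≡qᵉ⁺¹) ⟩
  primePowerProduct B (2 + N)   ∎
  where
  open ≤-Reasoning
  instance _ = prime⇒nonZero q-prime
  q≤B : q ≤ B
  q≤B = ≤-trans (m≤m*n q (q ^ e) {{m^n≢0 q e}}) (≤-trans (≤-reflexive (sym N+2≡qᵉ⁺¹)) N+2≤B)
  qᵉ≤N+1 : q ^ e ≤ suc N
  qᵉ≤N+1 = proper-factor≤ {{m^n≢0 q e}} (trans N+2≡qᵉ⁺¹ (*-comm q (q ^ e))) (prime⇒2≤ q-prime)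
  N+2∣qL : 2 + N ∣ q * lcmUpTo (suc N)
  N+2∣qL = subst (_∣ q * lcmUpTo (suc N)) (sym N+2≡qᵉ⁺¹) (*-monoʳ-∣ q (∣lcmUpTo (suc N) (m^n>0 q e) qᵉ≤N+1))

lcmUpTo≤N^primeCount : ∀ N → lcmUpTo N ≤ N ^ primeCount N
lcmUpTo≤N^primeCount zero = ≤-refl
lcmUpTo≤N^primeCount (suc N) = ≤-trans (lcmUpTo≤primePowerProduct (suc N) N ≤-refl) (primePowerProduct≤ (suc N) N)

chebyshev : ∀ n → 2 ^ n ≤ (n + n) ^ primeCount (n + n)
chebyshev zero = s≤s z≤n
chebyshev n@(suc _) = begin
  2 ^ n                          ≤⟨ 2^n≤[n+n]Cn n ⟩
  (n + n) C n                    ≤⟨ m≤n*m _ n ⟩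
  n * ((n + n) C n)              ≤⟨ ∣⇒≤ {{lcmUpTo-nonZero (n + n)}} (k*NCk∣lcmUpTo (s≤s z≤n) (m≤m+n n n)) ⟩
  lcmUpTo (n + n)                ≤⟨ lcmUpTo≤N^primeCount (n + n) ⟩
  (n + n) ^ primeCount (n + n)   ∎
  where open ≤-Reasoning

2^v≤[1+v]*primeCount[2^[1+v]] : ∀ v → 2 ^ v ≤ suc v * primeCount (2 ^ suc v)
2^v≤[1+v]*primeCount[2^[1+v]] v = subst₂ _≤_ (⌊log₂[2^n]⌋≡n (2 ^ v)) (⌊log₂[2^n]⌋≡n (suc v * π)) (⌊log₂⌋-mono-≤ (begin
  2 ^ (2 ^ v)                             ≤⟨ chebyshev (2 ^ v) ⟩
  (2 ^ v + 2 ^ v) ^ primeCount (2 ^ v + 2 ^ v) ≡⟨ cong (λ n → n ^ primeCount n) 2ᵛ+2ᵛ≡2ᵛ⁺¹ ⟩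
  (2 ^ suc v) ^ π                         ≡⟨ ^-*-assoc 2 (suc v) π ⟩
  2 ^ (suc v * π)                         ∎))
  where
  open ≤-Reasoning
  π = primeCount (2 ^ suc v)
  2ᵛ+2ᵛ≡2ᵛ⁺¹ : 2 ^ v + 2 ^ v ≡ 2 ^ suc v
  2ᵛ+2ᵛ≡2ᵛ⁺¹ = cong (2 ^ v +_) (sym (+-identityʳ (2 ^ v)))

cubic : ℕ → ℕ
cubic u = u * (4 * (u * u) + 4 * u)

cubic[1+u]≤2*cubic[u] : ∀ u → 15 ≤ u → cubic (suc u) ≤ 2 * cubic u
cubic[1+u]≤2*cubic[u] u 15≤u = +-cancelˡ-≤ (4 * (u * u * u)) (cubic (suc u)) (2 * cubic u) (begin
  4 * (u * u * u) + cubic (suc u)             ≡⟨ expand u ⟩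
  2 * cubic u + (8 * (u * u) + 20 * u + 8)     ≤⟨ +-monoʳ-≤ (2 * cubic u) quadratic≤cubic ⟩
  2 * cubic u + 4 * (u * u * u)                ≡⟨ +-comm (2 * cubic u) _ ⟩
  4 * (u * u * u) + 2 * cubic u                ∎)
  where
  open ≤-Reasoning
  expand : ∀ u → 4 * (u * u * u) + suc u * (4 * (suc u * suc u) + 4 * suc u)
                 ≡ 2 * (u * (4 * (u * u) + 4 * u)) + (8 * (u * u) + 20 * u + 8)
  expand = solve-∀
  1≤u = ≤-trans (s≤s z≤n) 15≤u
  u≤uu = m≤m*n u u {{>-nonZero 1≤u}}
  quadratic≤cubic : 8 * (u * u) + 20 * u + 8 ≤ 4 * (u * u * u)
  quadratic≤cubic = begin
    8 * (u * u) + 20 * u + 8                   ≤⟨ +-mono-≤ (+-monoʳ-≤ (8 * (u * u)) (*-monoʳ-≤ 20 u≤uu)) (*-monoʳ-≤ 8 (≤-trans 1≤u u≤uu)) ⟩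
    8 * (u * u) + 20 * (u * u) + 8 * (u * u)   ≡⟨ collect (u * u) ⟩
    36 * (u * u)                               ≤⟨ *-monoˡ-≤ (u * u) (≤-trans (≤ᵇ⇒≤ 36 60 tt) (*-monoʳ-≤ 4 15≤u)) ⟩
    4 * u * (u * u)                            ≡⟨ reassoc u ⟩
    4 * (u * u * u)                            ∎
    where
    collect : ∀ x → 8 * x + 20 * x + 8 * x ≡ 36 * x
    collect = solve-∀
    reassoc : ∀ u → 4 * u * (u * u) ≡ 4 * (u * u * u)
    reassoc = solve-∀

cubic[1+v]≤2^v : ∀ v → 14 ≤ v → cubic (suc v) ≤ 2 ^ v
cubic[1+v]≤2^v v 14≤v with m≤n⇒m<n∨m≡n 14≤v
... | inj₂ refl = ≤ᵇ⇒≤ _ _ tt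
cubic[1+v]≤2^v (suc v) _ | inj₁ (s≤s 14≤v) = begin
  cubic (2 + v)        ≤⟨ cubic[1+u]≤2*cubic[u] (suc v) (s≤s 14≤v) ⟩
  2 * cubic (suc v)    ≤⟨ *-monoʳ-≤ 2 (cubic[1+v]≤2^v v 14≤v) ⟩
  2 * 2 ^ v            ∎
  where open ≤-Reasoning

4u²+4u≤primeCount[2^u] : ∀ u → 15 ≤ u → 4 * (u * u) + 4 * u ≤ primeCount (2 ^ u)
4u²+4u≤primeCount[2^u] (suc v) (s≤s 14≤v) =
  *-cancelˡ-≤ (suc v) (≤-trans (cubic[1+v]≤2^v v 14≤v) (2^v≤[1+v]*primeCount[2^[1+v]] v))

-- From p_n² to p_(n+1)²

!-mono-≤ : ∀ {m n} → m ≤ n → m ! ≤ n !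
!-mono-≤ = ≤-mono-by-step _! λ n → m≤n*m (n !) (suc n)

m^j*m!≤[j+m]! : ∀ m j → m ^ j * m ! ≤ (j + m) !
m^j*m!≤[j+m]! m zero = ≤-reflexive (*-identityˡ (m !))
m^j*m!≤[j+m]! m (suc j) = begin
  m * m ^ j * m !       ≡⟨ *-assoc m (m ^ j) (m !) ⟩
  m * (m ^ j * m !)     ≤⟨ *-mono-≤ (m≤n⇒m≤1+n (m≤n+m m j)) (m^j*m!≤[j+m]! m j) ⟩
  suc (j + m) * (j + m) ! ∎
  where open ≤-Reasoning

ThetaLe⇒<4x : ∀ a x → 1 ≤ x → ThetaLe a x → a < 4 * x
ThetaLe⇒<4x a x 1≤x θa = ≰⇒> λ 4x≤a → <-irrefl refl (begin-strict
  (4 * x) !              ≤⟨ !-mono-≤ (m≤n⇒m≤1+n 4x≤a) ⟩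
  suc a !                ≤⟨ [1+a]!≤P a ⟩
  P a                    <⟨ LeExp⇒<2*[2m]^[2m] x θa ⟩
  2 * m ^ m              ≡⟨ *-comm 2 (m ^ m) ⟩
  m ^ m * 2              ≤⟨ *-monoʳ-≤ (m ^ m) (!-mono-≤ {2} (*-monoʳ-≤ 2 1≤x)) ⟩
  m ^ m * m !            ≤⟨ m^j*m!≤[j+m]! m m ⟩
  (m + m) !              ≡⟨ cong _! (2x+2x≡4x x) ⟩
  (4 * x) !              ∎)
  where
  open ≤-Reasoning
  m = 2 * x
  2x+2x≡4x : ∀ x → 2 * x + 2 * x ≡ 4 * x
  2x+2x≡4x = solve-∀

⌊n/2⌋+⌊n/2⌋≤n : ∀ n → ⌊ n /2⌋ + ⌊ n /2⌋ ≤ n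
⌊n/2⌋+⌊n/2⌋≤n n = subst (⌊ n /2⌋ + ⌊ n /2⌋ ≤_) (⌊n/2⌋+⌈n/2⌉≡n n) (+-monoʳ-≤ ⌊ n /2⌋ (⌊n/2⌋≤⌈n/2⌉ n))

n≤1+⌊n/2⌋+⌊n/2⌋ : ∀ n → n ≤ suc (⌊ n /2⌋ + ⌊ n /2⌋)
n≤1+⌊n/2⌋+⌊n/2⌋ n = begin
  n                          ≡⟨ ⌊n/2⌋+⌈n/2⌉≡n n ⟨
  ⌊ n /2⌋ + ⌈ n /2⌉          ≤⟨ +-monoʳ-≤ ⌊ n /2⌋ (⌊n/2⌋-mono (n≤1+n (suc n))) ⟩
  ⌊ n /2⌋ + suc ⌊ n /2⌋      ≡⟨ +-suc ⌊ n /2⌋ ⌊ n /2⌋ ⟩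
  suc (⌊ n /2⌋ + ⌊ n /2⌋)    ∎
  where open ≤-Reasoning

ThetaLe-step-large : ∀ a s gap → 1 ≤ s → 15 ≤ s + ⌊ gap /2⌋ →
                     ThetaLe a (s ^ 2) → ThetaLe (a + 2 * gap) ((gap + s) ^ 2)
ThetaLe-step-large a s@(suc s′) gap _ 15≤u θa =
  subst (ThetaLe M) (d+s²≡t² s gap) (LeExp-antimono (d + s ^ 2) PM≤2^d*Pa (LeExp-double d θa))
  where
  h = ⌊ gap /2⌋
  u = s + h
  M = a + 2 * gap
  d = gap * (s + (gap + s))
  d+s²≡t² : ∀ s gap → gap * (s + (gap + s)) + s * (s * 1) ≡ (gap + s) * ((gap + s) * 1)
  d+s²≡t² = solve-∀
  M≤4u²+4u : M ≤ 4 * (u * u) + 4 * u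
  M≤4u²+4u = ≤-pred (begin
    suc a + 2 * gap                       ≤⟨ +-mono-≤ (ThetaLe⇒<4x a (s ^ 2) (s≤s z≤n) θa) (*-monoʳ-≤ 2 (n≤1+⌊n/2⌋+⌊n/2⌋ gap)) ⟩
    4 * s ^ 2 + 2 * suc (h + h)           ≡⟨ regroup s′ h ⟩
    suc (4 * (s * s) + 4 * h + 1)         ≤⟨ s≤s (m≤m+n _ _) ⟩
    suc (4 * (s * s) + 4 * h + 1 + (8 * (s * h) + 4 * (h * h) + 4 * s′ + 3)) ≡⟨ cong suc (expand s′ h) ⟩
    suc (4 * (u * u) + 4 * u)             ∎)
    where
    open ≤-Reasoning
    regroup : ∀ s′ h → 4 * (suc s′ * (suc s′ * 1)) + 2 * suc (h + h) ≡ suc (4 * (suc s′ * suc s′) + 4 * h + 1)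
    regroup = solve-∀
    -- With s = s′ + 1, the difference (4u² + 4u) − (4s² + 4h + 1) has non-negative coefficients.
    expand : ∀ s′ h → 4 * (suc s′ * suc s′) + 4 * h + 1 + (8 * (suc s′ * h) + 4 * (h * h) + 4 * s′ + 3)
                    ≡ 4 * ((suc s′ + h) * (suc s′ + h)) + 4 * (suc s′ + h)
    expand = solve-∀
  pM≤2^u : p M ≤ 2 ^ u
  pM≤2^u = p≤ (2 ^ u) (≤-trans M≤4u²+4u (4u²+4u≤primeCount[2^u] u 15≤u))
  u*2gap≤d : u * (2 * gap) ≤ d
  u*2gap≤d = begin
    u * (2 * gap)            ≡⟨ regroup s h gap ⟩
    (h + h + 2 * s) * gap    ≤⟨ *-monoˡ-≤ gap (+-monoˡ-≤ (2 * s) (⌊n/2⌋+⌊n/2⌋≤n gap)) ⟩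
    (gap + 2 * s) * gap      ≡⟨ collect s gap ⟩
    d                        ∎
    where
    open ≤-Reasoning
    regroup : ∀ s h gap → (s + h) * (2 * gap) ≡ (h + h + 2 * s) * gap
    regroup = solve-∀
    collect : ∀ s gap → (gap + 2 * s) * gap ≡ gap * (s + (gap + s))
    collect = solve-∀
  PM≤2^d*Pa : P M ≤ 2 ^ d * P a
  PM≤2^d*Pa = begin
    P M                          ≡⟨ cong P (+-comm a (2 * gap)) ⟩
    P (2 * gap + a)              ≤⟨ P[k+a]≤P[a]*p[k+a]^k (2 * gap) a ⟩
    P a * p (2 * gap + a) ^ (2 * gap) ≡⟨ cong (λ i → P a * p i ^ (2 * gap)) (+-comm (2 * gap) a) ⟩
    P a * p M ^ (2 * gap)        ≤⟨ *-monoʳ-≤ (P a) (^-monoˡ-≤ (2 * gap) pM≤2^u) ⟩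
    P a * (2 ^ u) ^ (2 * gap)    ≡⟨ cong (P a *_) (^-*-assoc 2 u (2 * gap)) ⟩
    P a * 2 ^ (u * (2 * gap))    ≤⟨ *-monoʳ-≤ (P a) (^-monoʳ-≤ 2 u*2gap≤d) ⟩
    P a * 2 ^ d                  ≡⟨ *-comm (P a) (2 ^ d) ⟩
    2 ^ d * P a                  ∎
    where open ≤-Reasoning

ThetaLe-jump : ∀ {x y} A k → ¬ ThetaLe (suc A) x → ThetaLe (A + k) y → ∀ a → ThetaLe a x → ThetaLe (a + k) y
ThetaLe-jump {x} {y} A k ¬θ[1+A] θ[A+k] a θa = ThetaLe-antimono y (+-monoˡ-≤ k a≤A) θ[A+k]
  where
  a≤A : a ≤ A
  a≤A = ≮⇒≥ λ A<a → ¬θ[1+A] (ThetaLe-antimono x A<a θa)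

-- For n ≤ 5, π_ϑ(p_n²) ≤ A and ϑ_(A+2g_n) ≤ p_(n+1)² are certified by partial sums of e^x of the given orders.
ThetaLe-step : ∀ n → 1 ≤ n → ∀ a → ThetaLe a (p n ^ 2) → ThetaLe (a + 2 * g n) (p (suc n) ^ 2)
ThetaLe-step 1 _ = ThetaLe-jump 3 2 (¬LeExp-by-tail {P 4} 4 30 (≤ᵇ⇒≤ _ _ tt) (≤ᵇ⇒≤ _ _ tt)) (LeExp-witness {P 5} {9} 30 (≤ᵇ⇒≤ _ _ tt))
ThetaLe-step 2 _ = ThetaLe-jump 5 4 (¬LeExp-by-tail {P 6} 9 40 (≤ᵇ⇒≤ _ _ tt) (≤ᵇ⇒≤ _ _ tt)) (LeExp-witness {P 9} {25} 80 (≤ᵇ⇒≤ _ _ tt))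
ThetaLe-step 3 _ = ThetaLe-jump 10 4 (¬LeExp-by-tail {P 11} 25 80 (≤ᵇ⇒≤ _ _ tt) (≤ᵇ⇒≤ _ _ tt)) (LeExp-witness {P 14} {49} 150 (≤ᵇ⇒≤ _ _ tt))
ThetaLe-step 4 _ = ThetaLe-jump 16 8 (¬LeExp-by-tail {P 17} 49 120 (≤ᵇ⇒≤ _ _ tt) (≤ᵇ⇒≤ _ _ tt)) (LeExp-witness {P 24} {121} 360 (≤ᵇ⇒≤ _ _ tt))
ThetaLe-step 5 _ = ThetaLe-jump 32 4 (¬LeExp-by-tail {P 33} 121 280 (≤ᵇ⇒≤ _ _ tt) (≤ᵇ⇒≤ _ _ tt)) (LeExp-witness {P 36} {169} 500 (≤ᵇ⇒≤ _ _ tt))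
ThetaLe-step n@(suc (suc (suc (suc (suc (suc k)))))) _ a θa =
  subst (λ t → ThetaLe (a + 2 * g n) (t ^ 2)) (m∸n+n≡m (<⇒≤ (p-< (5 + k))))
    (ThetaLe-step-large a (p n) (g n) (≤-trans (s≤s z≤n) (2+i≤p[1+i] (5 + k))) (15≤u k) θa)
  where
  15≤u : ∀ k → 15 ≤ p (6 + k) + ⌊ g (6 + k) /2⌋
  15≤u zero = ≤ᵇ⇒≤ _ _ tt
  15≤u (suc k) = ≤-trans (≤ᵇ⇒≤ 15 (p 7) tt) (≤-trans (p-mono-≤ (m≤m+n 7 k)) (m≤m+n _ _))

mainTheorem9 : (n : ℕ) → 1 ≤ n → (a b : ℕ) →
    PiThetaIs (p n ^ 2) a → PiThetaIs (p (suc n) ^ 2) b →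
    a + 2 * g n ≤ b
mainTheorem9 n 1≤n a b count[pₙ²]≡a count[pₙ₊₁²]≡b =
  ≤count (a + 2 * g n) count[pₙ₊₁²]≡b (ThetaLe-step n 1≤n a (count-ThetaLe count[pₙ²]≡a))
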